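{- Let $\mathcal{A}=\langle Q,q_0,\delta,\omega\rangle$ be an AAPTA over $\Sigma$ having a state $q_\top$ from which every $\Sigma$-labelled tree is accepted, let $E$ be a finite multiset over $Q$, and let $\mathcal{T}$ be a $\Sigma$-labelled tree. If $\mathcal{T}$ is not accepted by $\mathcal{A}_{\rhd E}$, then there exist a multiset $F\sqsubseteq E$ and a state $g\in\mathrm{supp}(E\ominus F)$ such that $\mathcal{T}$ is accepted by $\mathcal{A}_{\rhd F}$ and rejected by $\mathcal{A}_{\rhd F\uplus\{\!\{g\}\!\}}$.
   Context: Multisets over $S$: maps $\mu:S\to\mathbb{N}$; $\mu\sqsubseteq\mu'$ pointwise; $(\mu\ominus\mu')(s)=\max(0,\mu(s)-\mu'(s))$; $\mu\uplus\mu'$ pointwise sum; $\mathrm{supp}(\mu)=\{s:\mu(s)>0\}$. An EU-pair $\langle E;U\rangle$ over $S$ ($E$ finite multiset, $U\subseteq S$) is satisfied by $\mu$ if $E\sqsubseteq\mu$ and $\mathrm{supp}(\mu\ominus E)\subseteq U$. A marking $\nu:S'\to 2^S$ satisfies $\langle E;U\rangle$ if some choice function $\nu'(s')\in\nu(s')$ has image multiset $s\mapsto|\{s':\nu'(s')=s\}|$ satisfying it; extended to positive boolean formulas over EU-pairs ($\top,\bot,\wedge,\vee$). An AAPTA over $\Sigma$ is $\langle Q,q_0,\delta,\omega\rangle$ with $\delta(q,\sigma)$ a positive boolean formula over EU-pairs over $Q$ and priorities $\omega:Q\to\mathbb{N}$. Trees: $t\subseteq D^*$ prefix-closed ($D$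 finite), labelled $l:t\to\Sigma$. An execution tree over $(t,l)$ is a $(D\times Q)$-tree, node $(d_1,q_1)\cdots(d_k,q_k)$ labelled $(d_1\cdots d_k,q_k)$, root $(\varepsilon,q_0)$, such that for each node $x$ labelled $(m,q)$ the marking $m\cdot d\mapsto\{q':x\cdot(d,q')\text{ is a node}\}$ satisfies $\delta(q,l(m))$; accepting if on every infinite branch the least priority seen infinitely often is even; a tree is accepted if it has an accepting execution tree, rejected otherwise. For a finite multiset $E$ over $Q$, $\mathcal{A}_{\rhd E}=\langle Q\cup\{q_E\},q_E,\delta_E,\omega_E\rangle$ where $q_E\notin Q$ is a new state, $\delta_E(q_E,\sigma)=\langle E;\{q_\top\}\rangle$ for all $\sigma\in\Sigma$, $\delta_E(q,\sigma)=\delta(q,\sigma)$ for $q\in Q$, $\omega_E$ coincides with $\omega$ on $Q$ and $\omega_E(q_E)=0$. -}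

module Defs where

open import Data.Nat using (ℕ; zero; suc; _+_; _∸_; _≤_; _<_; _%_)
open import Data.Fin using (Fin; zero; suc; _≟_)
open import Data.Fin.Subset using (Subset; ⁅_⁆; _∈_)
open import Data.List using (List; []; _∷_; _∷ʳ_; map; allFin)
open import Data.Nat.ListAction using (sum)
open import Data.Product using (Σ; ∃; _×_; _,_; proj₁; proj₂)
open import Data.Sum using (_⊎_)
open import Data.Bool using (Bool; true; false; T; if_then_else_)
open import Data.Vec using (_∷_)
open import Data.Unit using (⊤; tt)
open import Data.Empty using (⊥)
open import Relation.Nullary using (¬_)
open import Relation.Nullary.Decidable using (⌊_⌋)
open import Relation.Binary.PropositionalEquality using (_≡_)

Multiset : ℕ → Set
Multiset n = Fin n → ℕ

_⊑_ : ∀ {n} → Multiset n → Multiset n → Set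
μ ⊑ μ' = ∀ q → μ q ≤ μ' q

_⊖_ : ∀ {n} → Multiset n → Multiset n → Multiset n
(μ ⊖ μ') q = μ q ∸ μ' q

_⊎ₘ_ : ∀ {n} → Multiset n → Multiset n → Multiset n
(μ ⊎ₘ μ') q = μ q + μ' q

_∈supp_ : ∀ {n} → Fin n → Multiset n → Set
q ∈supp μ = 0 < μ q

｛_｝ₘ : ∀ {n} → Fin n → Multiset n
｛ g ｝ₘ q = if ⌊ q ≟ g ⌋ then 1 else 0

record EU (n : ℕ) : Set where
  constructor ⟨_⨾_⟩
  field
    E : Multiset n
    U : Subset n
open EU public

_⊨ₘ_ : ∀ {n} → Multiset n → EU n → Set
μ ⊨ₘ eu = (E eu ⊑ μ) × (∀ q → q ∈supp (μ ⊖ E eu) → q ∈ U eu)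

data PBF (A : Set) : Set where
  ⊤ᶠ ⊥ᶠ : PBF A
  atom : A → PBF A
  _∧ᶠ_ _∨ᶠ_ : PBF A → PBF A → PBF A

mapPBF : ∀ {A B : Set} → (A → B) → PBF A → PBF B
mapPBF f ⊤ᶠ = ⊤ᶠ
mapPBF f ⊥ᶠ = ⊥ᶠ
mapPBF f (atom a) = atom (f a)
mapPBF f (φ ∧ᶠ ψ) = mapPBF f φ ∧ᶠ mapPBF f ψ
mapPBF f (φ ∨ᶠ ψ) = mapPBF f φ ∨ᶠ mapPBF f ψ

-- Markings ν : S' → 2^S, with S' = {d : Fin k | dom d} and S = Fin n.

record Marking (k n : ℕ) : Set where
  field
    dom : Fin k → Bool
    ν   : Fin k → Fin n → Bool
open Marking public

record Choice {k n : ℕ} (m : Marking k n) : Set where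
  field
    ch    : (d : Fin k) → T (dom m d) → Fin n
    ch∈ν  : (d : Fin k) (p : T (dom m d)) → T (ν m d (ch d p))
open Choice public

indicator : ∀ {n} (b : Bool) → (T b → Fin n) → Fin n → ℕ
indicator false f q = 0
indicator true  f q = if ⌊ f tt ≟ q ⌋ then 1 else 0

image : ∀ {k n} {m : Marking k n} → Choice m → Multiset n
image {k} {m = m} c q = sum (map (λ d → indicator (dom m d) (ch c d) q) (allFin k))

_⊨EU_ : ∀ {k n} → Marking k n → EU n → Set
m ⊨EU eu = Σ (Choice m) λ c → image c ⊨ₘ eu

_⊨_ : ∀ {k n} → Marking k n → PBF (EU n) → Set
m ⊨ ⊤ᶠ = ⊤
m ⊨ ⊥ᶠ = ⊥
m ⊨ atom eu = m ⊨EU eu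
m ⊨ (φ ∧ᶠ ψ) = (m ⊨ φ) × (m ⊨ ψ)
m ⊨ (φ ∨ᶠ ψ) = (m ⊨ φ) ⊎ (m ⊨ ψ)

record AAPTA (Σ' : Set) (n : ℕ) : Set where
  field
    q₀ : Fin n
    δ  : Fin n → Σ' → PBF (EU n)
    ω  : Fin n → ℕ
open AAPTA public

withInit : ∀ {Σ' n} → AAPTA Σ' n → Fin n → AAPTA Σ' n
withInit A q = record { q₀ = q ; δ = δ A ; ω = ω A }

record LTree (Σ' : Set) (k : ℕ) : Set where
  field
    mem    : List (Fin k) → Bool
    root   : T (mem [])
    closed : ∀ xs d → T (mem (xs ∷ʳ d)) → T (mem xs)
    label  : List (Fin k) → Σ'
open LTree public

-- state component of the label of an execution-tree node (root: q₀)
stateOf : ∀ {k n} → Fin n → List (Fin k × Fin n) → Fin n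
stateOf q [] = q
stateOf q (p ∷ xs) = stateOf (proj₂ p) xs

prefix : ∀ {A : Set} → (ℕ → A) → ℕ → List A
prefix β zero = []
prefix β (suc i) = prefix β i ∷ʳ β i

InfinitelyOften : (ℕ → ℕ) → ℕ → Set
InfinitelyOften π p = ∀ i → ∃ λ j → (i ≤ j) × (π j ≡ p)

ParityAccepting : (ℕ → ℕ) → Set
ParityAccepting π =
  ∃ λ p → (p % 2 ≡ 0) × InfinitelyOften π p × (∀ p' → p' < p → ¬ InfinitelyOften π p')

record ExecTree {Σ' n k} (A : AAPTA Σ' n) (𝒯 : LTree Σ' k) : Set where
  field
    node   : List (Fin k × Fin n) → Bool
    root   : T (node [])
    closed : ∀ x p → T (node (x ∷ʳ p)) → T (node x)
    inTree : ∀ x d q → T (node (x ∷ʳ (d , q))) → T (mem 𝒯 (map proj₁ x ∷ʳ d))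
    local  : ∀ x → T (node x) →
             record { dom = λ d → mem 𝒯 (map proj₁ x ∷ʳ d)
                    ; ν   = λ d q' → node (x ∷ʳ (d , q')) }
             ⊨ δ A (stateOf (q₀ A) x) (label 𝒯 (map proj₁ x))
open ExecTree public

AcceptingExec : ∀ {Σ' : Set} {n k : ℕ} {A : AAPTA Σ' n} {𝒯 : LTree Σ' k} → ExecTree A 𝒯 → Set
AcceptingExec {Σ'} {n} {k} {A} X =
  (β : ℕ → Fin k × Fin n) → (∀ i → T (node X (prefix β i))) →
  ParityAccepting (λ i → ω A (proj₂ (β i)))

Accepts : ∀ {Σ' n k} → AAPTA Σ' n → LTree Σ' k → Set
Accepts A 𝒯 = Σ (ExecTree A 𝒯) AcceptingExec

Rejects : ∀ {Σ' n k} → AAPTA Σ' n → LTree Σ' k → Set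
Rejects A 𝒯 = ¬ Accepts A 𝒯

-- 𝒜_{▷E}: states Fin (suc n); q_E = zero, old state q is suc q.

liftMS : ∀ {n} → Multiset n → Multiset (suc n)
liftMS μ zero = 0
liftMS μ (suc q) = μ q

liftEU : ∀ {n} → EU n → EU (suc n)
liftEU ⟨ e ⨾ u ⟩ = ⟨ liftMS e ⨾ false ∷ u ⟩

_▷_ : ∀ {Σ' n} → AAPTA Σ' n → (q⊤ : Fin n) → Multiset n → AAPTA Σ' (suc n)
(A ▷ q⊤) e = record
  { q₀ = zero
  ; δ  = δE
  ; ω  = ωE }
  where
  δE : Fin _ → _ → PBF (EU _)
  δE zero σ = atom ⟨ liftMS e ⨾ ⁅ suc q⊤ ⁆ ⟩
  δE (suc q) σ = mapPBF liftEU (δ A q σ)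
  ωE : Fin _ → ℕ
  ωE zero = 0
  ωE (suc q) = ω A q

-- 𝒜_{▷∅} accepts every tree: its root sends q⊤ to every root direction, and below that it runs
-- the accepting executions of 𝒜 from q⊤.  Since 𝒜_{▷E} rejects 𝒯, climbing from ∅ to E one state
-- at a time must hit a step F ↦ F ⊎ {{g}} at which acceptance is lost; excluded middle decides
-- acceptance at each step, and the size of E ⊖ F bounds the climb.
module Submission where

open import Defs
open import Data.Nat using (ℕ; zero; suc; _∸_; _≤_; _<_; _<?_; z≤n; s≤s; s≤s⁻¹)
open import Data.Nat.Properties
  using (≤-refl; ≤-trans; ≤-antisym; <-≤-trans; ≮⇒≥; n≤1+n; n<1+n; m≤m+n; +-comm; +-identityʳ;
         n≮0; +-mono-≤; +-mono-<-≤; +-mono-≤-<; ∸-monoʳ-≤; ∸-monoʳ-<; m<n⇒0<n∸m)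
open import Data.Nat.ListAction using (sum)
open import Data.Fin using (Fin; zero; suc; _≟_)
open import Data.Fin.Properties using (any?)
open import Data.Fin.Subset using (Subset; ⁅_⁆; _∈_)
open import Data.Fin.Subset.Properties using (x∈⁅x⁆)
open import Data.Vec.Base using (_∷_; there)
open import Data.List using (List; []; _∷_; _∷ʳ_; map; allFin)
open import Data.Bool.ListAction using (all)
open import Data.List.Properties using (map-cong; map-++)
open import Data.List.Membership.Propositional using () renaming (_∈_ to _∈ˡ_)
open import Data.List.Membership.Propositional.Properties using (∈-allFin)
open import Data.List.Relation.Unary.All using (All; []; _∷_)
open import Data.List.Relation.Unary.All.Properties using (all⁺; all⁻; ∷ʳ⁺; ∷ʳ⁻)
open import Data.List.Relation.Unary.Any using (here; there)
open import Data.Bool using (Bool; true; false; T; _∧_)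
open import Data.Bool.Properties using (T-∧)
open import Data.Unit using (tt)
open import Data.Empty using (⊥-elim)
open import Data.Product using (∃₂; _×_; _,_; proj₁; proj₂; map₂)
open import Data.Sum using (inj₁; inj₂)
open import Function using (_∘_)
open import Function.Bundles using (Equivalence)
open import Relation.Nullary using (¬_; yes; no)
open import Relation.Nullary.Decidable using (⌊_⌋; toWitness; fromWitness)
open import Relation.Binary.PropositionalEquality
  using (_≡_; _≢_; _≗_; refl; sym; trans; cong; cong₂; subst; subst₂)
open import Level using (0ℓ)
open import Axiom.ExcludedMiddle using (ExcludedMiddle)

open Equivalence using (to; from)

_∧ᵈ_ : (b : Bool) → (T b → Bool) → Bool
false ∧ᵈ f = false
true  ∧ᵈ f = f tt

∧ᵈ-intro : ∀ {b} {f : T b → Bool} (p : T b) → T (f p) → T (b ∧ᵈ f)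
∧ᵈ-intro {true} _ h = h

∧ᵈ-elimˡ : ∀ {b} {f : T b → Bool} → T (b ∧ᵈ f) → T b
∧ᵈ-elimˡ {true} _ = tt

∧ᵈ-elimʳ : ∀ {b} {f : T b → Bool} (p : T b) → T (b ∧ᵈ f) → T (f p)
∧ᵈ-elimʳ {true} _ h = h

sum-map-mono-≤ : ∀ {A : Set} {f h : A → ℕ} (xs : List A) →
                 (∀ x → f x ≤ h x) → sum (map f xs) ≤ sum (map h xs)
sum-map-mono-≤ []       f≤h = z≤n
sum-map-mono-≤ (x ∷ xs) f≤h = +-mono-≤ (f≤h x) (sum-map-mono-≤ xs f≤h)

sum-map-mono-< : ∀ {A : Set} {f h : A → ℕ} {y : A} (xs : List A) → (∀ x → f x ≤ h x) →
                 y ∈ˡ xs → f y < h y → sum (map f xs) < sum (map h xs)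
sum-map-mono-< (x ∷ xs) f≤h (here refl) fy<hy = +-mono-<-≤ fy<hy (sum-map-mono-≤ xs f≤h)
sum-map-mono-< (x ∷ xs) f≤h (there y∈xs) fy<hy = +-mono-≤-< (f≤h x) (sum-map-mono-< xs f≤h y∈xs fy<hy)

sum-map-zero : ∀ {A : Set} {f : A → ℕ} (xs : List A) → (∀ x → f x ≡ 0) → sum (map f xs) ≡ 0
sum-map-zero []       f≡0 = refl
sum-map-zero (x ∷ xs) f≡0 rewrite f≡0 x = sum-map-zero xs f≡0

size : ∀ {n} → Multiset n → ℕ
size {n} μ = sum (map μ (allFin n))

size-mono-< : ∀ {n} {μ ν : Multiset n} {q : Fin n} → μ ⊑ ν → μ q < ν q → size μ < size ν
size-mono-< μ⊑ν = sum-map-mono-< (allFin _) μ⊑ν (∈-allFin _)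

⊎ₘ-｛｝ₘ-self : ∀ {n} (F : Multiset n) (g : Fin n) → (F ⊎ₘ ｛ g ｝ₘ) g ≡ suc (F g)
⊎ₘ-｛｝ₘ-self F g with g ≟ g
... | yes _   = +-comm (F g) 1
... | no g≢g = ⊥-elim (g≢g refl)

⊎ₘ-｛｝ₘ-⊑ : ∀ {n} {F E : Multiset n} {g : Fin n} → F ⊑ E → F g < E g → (F ⊎ₘ ｛ g ｝ₘ) ⊑ E
⊎ₘ-｛｝ₘ-⊑ {F = F} {E} {g} F⊑E Fg<Eg q with q ≟ g
... | yes refl = subst (_≤ E q) (+-comm 1 (F q)) Fg<Eg
... | no _     = subst (_≤ E q) (sym (+-identityʳ (F q))) (F⊑E q)

size-⊖-⊎ₘ-｛｝ₘ : ∀ {n} {F E : Multiset n} {g : Fin n} → F g < E g →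
                  size (E ⊖ (F ⊎ₘ ｛ g ｝ₘ)) < size (E ⊖ F)
size-⊖-⊎ₘ-｛｝ₘ {F = F} {E} {g} Fg<Eg = size-mono-< {q = g} shrink strict
  where
  shrink : (E ⊖ (F ⊎ₘ ｛ g ｝ₘ)) ⊑ (E ⊖ F)
  shrink q = ∸-monoʳ-≤ (E q) (m≤m+n (F q) _)
  strict : E g ∸ (F ⊎ₘ ｛ g ｝ₘ) g < E g ∸ F g
  strict rewrite ⊎ₘ-｛｝ₘ-self F g = ∸-monoʳ-< (n<1+n (F g)) Fg<Eg

boundary-increment :
  ExcludedMiddle 0ℓ → ∀ {n} (P : Multiset n → Set) → (∀ {F G} → F ≗ G → P F → P G) →
  (E F : Multiset n) → F ⊑ E → P F → ¬ P E →
  ∃₂ λ (F' : Multiset n) (g : Fin n) →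
    (F' ⊑ E) × (g ∈supp (E ⊖ F')) × P F' × ¬ P (F' ⊎ₘ ｛ g ｝ₘ)
boundary-increment lem {n} P P-resp E F₀ F₀⊑E PF₀ ¬PE = climb _ F₀ F₀⊑E PF₀ ≤-refl
  where
  climb : ∀ N F → F ⊑ E → P F → size (E ⊖ F) < N →
          ∃₂ λ (F' : Multiset n) (g : Fin n) →
            (F' ⊑ E) × (g ∈supp (E ⊖ F')) × P F' × ¬ P (F' ⊎ₘ ｛ g ｝ₘ)
  climb (suc N) F F⊑E PF gap<N with any? (λ g → F g <? E g)
  ... | no F≮E = ⊥-elim (¬PE (P-resp F≗E PF))
    where
    F≗E : F ≗ E
    F≗E q = ≤-antisym (F⊑E q) (≮⇒≥ λ Fq<Eq → F≮E (q , Fq<Eq))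
  ... | yes (g , Fg<Eg) with lem {P (F ⊎ₘ ｛ g ｝ₘ)}
  ...   | no ¬PF+g = F , g , F⊑E , m<n⇒0<n∸m Fg<Eg , PF , ¬PF+g
  ...   | yes PF+g = climb N (F ⊎ₘ ｛ g ｝ₘ) (⊎ₘ-｛｝ₘ-⊑ F⊑E Fg<Eg) PF+g
                       (<-≤-trans (size-⊖-⊎ₘ-｛｝ₘ {F = F} {E} Fg<Eg) (s≤s⁻¹ gap<N))

InfinitelyOften-cong : ∀ {π π' p} → π ≗ π' → InfinitelyOften π p → InfinitelyOften π' p
InfinitelyOften-cong π≗π' io i =
  let j , i≤j , πj≡p = io i in j , i≤j , trans (sym (π≗π' j)) πj≡p

InfinitelyOften-tail⁺ : ∀ {π p} → InfinitelyOften (π ∘ suc) p → InfinitelyOften π p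
InfinitelyOften-tail⁺ io i = let j , i≤j , πj≡p = io i in suc j , ≤-trans i≤j (n≤1+n j) , πj≡p

InfinitelyOften-tail⁻ : ∀ {π p} → InfinitelyOften π p → InfinitelyOften (π ∘ suc) p
InfinitelyOften-tail⁻ io i with io (suc i)
... | suc j , s≤s i≤j , πj≡p = j , i≤j , πj≡p

ParityAccepting-cong : ∀ {π π'} → π ≗ π' → ParityAccepting π → ParityAccepting π'
ParityAccepting-cong π≗π' (p , even , io , least) =
  p , even , InfinitelyOften-cong π≗π' io ,
  λ p' p'<p io' → least p' p'<p (InfinitelyOften-cong (sym ∘ π≗π') io')

ParityAccepting-tail : ∀ {π} → ParityAccepting (π ∘ suc) → ParityAccepting π
ParityAccepting-tail (p , even , io , least) =
  p , even , InfinitelyOften-tail⁺ io ,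
  λ p' p'<p io' → least p' p'<p (InfinitelyOften-tail⁻ io')

prefix-tail : ∀ {A : Set} (β : ℕ → A) i → prefix β (suc i) ≡ β 0 ∷ prefix (β ∘ suc) i
prefix-tail β zero    = refl
prefix-tail β (suc i) = cong (_∷ʳ β (suc i)) (prefix-tail β i)

map-prefix : ∀ {A B : Set} (f : A → B) (β : ℕ → A) i → map f (prefix β i) ≡ prefix (f ∘ β) i
map-prefix f β zero    = refl
map-prefix f β (suc i) = trans (map-++ f (prefix β i) _) (cong (_∷ʳ f (β i)) (map-prefix f β i))

⊨ₘ-resp : ∀ {n} {μ μ' E E' : Multiset n} {U : Subset n} →
          μ ≗ μ' → E ≗ E' → μ ⊨ₘ ⟨ E ⨾ U ⟩ → μ' ⊨ₘ ⟨ E' ⨾ U ⟩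
⊨ₘ-resp μ≗μ' E≗E' (E⊑μ , rest⊆U) =
  (λ q → subst₂ _≤_ (E≗E' q) (μ≗μ' q) (E⊑μ q)) ,
  (λ q h → rest⊆U q (subst (0 <_) (sym (cong₂ _∸_ (μ≗μ' q) (E≗E' q))) h))

liftMS-cong : ∀ {n} {F G : Multiset n} → F ≗ G → liftMS F ≗ liftMS G
liftMS-cong F≗G zero    = refl
liftMS-cong F≗G (suc q) = F≗G q

⊨ₘ-liftMS : ∀ {n} {μ E : Multiset n} {U : Subset n} →
            μ ⊨ₘ ⟨ E ⨾ U ⟩ → liftMS μ ⊨ₘ liftEU ⟨ E ⨾ U ⟩
⊨ₘ-liftMS (E⊑μ , rest⊆U) = lifted-⊑ , lifted-⊆
  where
  lifted-⊑ : liftMS _ ⊑ liftMS _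
  lifted-⊑ zero    = z≤n
  lifted-⊑ (suc q) = E⊑μ q
  lifted-⊆ : ∀ q → q ∈supp (liftMS _ ⊖ liftMS _) → q ∈ (false ∷ _)
  lifted-⊆ zero    ()
  lifted-⊆ (suc q) h = there (rest⊆U q h)

_⊆ₘ_ : ∀ {k n} → Marking k n → Marking k n → Set
m ⊆ₘ m' = (∀ d → dom m d ≡ dom m' d) ×
          (∀ d → T (dom m d) → ∀ q → T (ν m d q) → T (ν m' d q))

indicator-subst : ∀ {n} {b b' : Bool} (b≡b' : b ≡ b') (f : T b → Fin n) q →
                  indicator b' (f ∘ subst T (sym b≡b')) q ≡ indicator b f q
indicator-subst refl f q = refl

⊨EU-mono : ∀ {k n} {m m' : Marking k n} {eu : EU n} → m ⊆ₘ m' → m ⊨EU eu → m' ⊨EU eu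
⊨EU-mono {k} {m = m} {m'} {⟨ e ⨾ u ⟩} (dom≡ , ν⊆) (c , sat) =
  c' , ⊨ₘ-resp same-image (λ _ → refl) sat
  where
  back : ∀ d → T (dom m' d) → T (dom m d)
  back d = subst T (sym (dom≡ d))
  c' : Choice m'
  c' = record { ch = λ d p → ch c d (back d p)
              ; ch∈ν = λ d p → ν⊆ d (back d p) _ (ch∈ν c d (back d p)) }
  same-image : image c ≗ image c'
  same-image q = sym (cong sum (map-cong (λ d → indicator-subst (dom≡ d) (ch c d) q) (allFin k)))

⊨-mono : ∀ {k n} {m m' : Marking k n} → m ⊆ₘ m' → ∀ φ → m ⊨ φ → m' ⊨ φ
⊨-mono m⊆m' ⊤ᶠ       _        = tt
⊨-mono m⊆m' (atom eu) h        = ⊨EU-mono {eu = eu} m⊆m' h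
⊨-mono m⊆m' (φ ∧ᶠ ψ) (hφ , hψ) = ⊨-mono m⊆m' φ hφ , ⊨-mono m⊆m' ψ hψ
⊨-mono m⊆m' (φ ∨ᶠ ψ) (inj₁ hφ) = inj₁ (⊨-mono m⊆m' φ hφ)
⊨-mono m⊆m' (φ ∨ᶠ ψ) (inj₂ hψ) = inj₂ (⊨-mono m⊆m' ψ hψ)

liftMarking : ∀ {k n} → Marking k n → Marking k (suc n)
liftMarking m = record { dom = dom m ; ν = λ { d zero → false ; d (suc q) → ν m d q } }

liftChoice : ∀ {k n} {m : Marking k n} → Choice m → Choice (liftMarking m)
liftChoice c = record { ch = λ d p → suc (ch c d p) ; ch∈ν = ch∈ν c }

indicator-suc : ∀ {n} (b : Bool) (f : T b → Fin n) q →
                indicator b (λ p → suc (f p)) q ≡ liftMS (indicator b f) q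
indicator-suc b     f zero    with b
... | false = refl
... | true  = refl
indicator-suc false f (suc q) = refl
indicator-suc true  f (suc q) with f tt ≟ q
... | yes _ = refl
... | no _  = refl

image-liftChoice : ∀ {k n} {m : Marking k n} (c : Choice m) → image (liftChoice c) ≗ liftMS (image c)
image-liftChoice {k} {m = m} c zero =
  sum-map-zero (allFin k) (λ d → indicator-suc (dom m d) (ch c d) zero)
image-liftChoice {k} {m = m} c (suc q) =
  cong sum (map-cong (λ d → indicator-suc (dom m d) (ch c d) (suc q)) (allFin k))

⊨-liftMarking : ∀ {k n} (m : Marking k n) φ → m ⊨ φ → liftMarking m ⊨ mapPBF liftEU φ
⊨-liftMarking m ⊤ᶠ               _         = tt
⊨-liftMarking m (atom ⟨ e ⨾ u ⟩) (c , sat) =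
  liftChoice c , ⊨ₘ-resp (sym ∘ image-liftChoice c) (λ _ → refl) (⊨ₘ-liftMS sat)
⊨-liftMarking m (φ ∧ᶠ ψ) (hφ , hψ) = ⊨-liftMarking m φ hφ , ⊨-liftMarking m ψ hψ
⊨-liftMarking m (φ ∨ᶠ ψ) (inj₁ hφ) = inj₁ (⊨-liftMarking m φ hφ)
⊨-liftMarking m (φ ∨ᶠ ψ) (inj₂ hψ) = inj₂ (⊨-liftMarking m ψ hψ)

constMarking : ∀ {k n} → (Fin k → Bool) → Fin n → Marking k n
constMarking D s = record { dom = D ; ν = λ _ q → ⌊ q ≟ s ⌋ }

constMarking-⊨ : ∀ {k n} (D : Fin k → Bool) (s : Fin n) {E : Multiset n} →
                 (∀ q → E q ≡ 0) → constMarking D s ⊨EU ⟨ E ⨾ ⁅ s ⁆ ⟩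
constMarking-⊨ {k} D s {E} E≡0 = c , E⊑image , rest⊆⁅s⁆
  where
  c : Choice (constMarking D s)
  c = record { ch = λ _ _ → s ; ch∈ν = λ _ _ → fromWitness refl }
  E⊑image : E ⊑ image c
  E⊑image q = subst (_≤ image c q) (sym (E≡0 q)) z≤n
  image-off-s : ∀ {q} → q ≢ s → image c q ≡ 0
  image-off-s {q} q≢s = sum-map-zero (allFin k) off
    where
    off : ∀ d → indicator (D d) (λ _ → s) q ≡ 0
    off d with D d
    ... | false = refl
    ... | true with s ≟ q
    ...   | yes s≡q = ⊥-elim (q≢s (sym s≡q))
    ...   | no _    = refl
  rest⊆⁅s⁆ : ∀ q → q ∈supp (image c ⊖ E) → q ∈ ⁅ s ⁆
  rest⊆⁅s⁆ q h with q ≟ s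
  ... | yes refl = x∈⁅x⁆ s
  ... | no q≢s = ⊥-elim (n≮0 (subst (0 <_) (cong₂ _∸_ (image-off-s q≢s) (E≡0 q)) h))

childMarking : ∀ {Σ' k n} → LTree Σ' k → (List (Fin k × Fin n) → Bool) →
               List (Fin k × Fin n) → Marking k n
childMarking 𝒯 node x =
  record { dom = λ d → mem 𝒯 (map proj₁ x ∷ʳ d) ; ν = λ d q → node (x ∷ʳ (d , q)) }

subtree : ∀ {Σ' k} (𝒯 : LTree Σ' k) (d : Fin k) → T (mem 𝒯 (d ∷ [])) → LTree Σ' k
subtree 𝒯 d d∈𝒯 = record
  { mem    = λ xs → mem 𝒯 (d ∷ xs)
  ; root   = d∈𝒯
  ; closed = λ xs → closed 𝒯 (d ∷ xs)
  ; label  = λ xs → label 𝒯 (d ∷ xs) }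

accepts-mono : ∀ {Σ' n k} {B C : AAPTA Σ' n} {𝒯 : LTree Σ' k} (q : Fin n) →
               (∀ {m : Marking k n} s σ → m ⊨ δ B s σ → m ⊨ δ C s σ) → ω B ≗ ω C →
               Accepts (withInit B q) 𝒯 → Accepts (withInit C q) 𝒯
accepts-mono q δB⇒δC ωB≗ωC (X , X-acc) =
  record { node = node X ; root = root X ; closed = closed X ; inTree = inTree X
         ; local = λ x h → δB⇒δC _ _ (local X x h) } ,
  λ β on-X → ParityAccepting-cong (ωB≗ωC ∘ proj₂ ∘ β) (X-acc β on-X)

▷-accepts-cong : ∀ {Σ' n k} (A : AAPTA Σ' n) (q⊤ : Fin n) {F G : Multiset n} {𝒯 : LTree Σ' k} →
                 F ≗ G → Accepts ((A ▷ q⊤) F) 𝒯 → Accepts ((A ▷ q⊤) G) 𝒯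
▷-accepts-cong {n = n} A q⊤ {F} {G} F≗G =
  accepts-mono {B = (A ▷ q⊤) F} {C = (A ▷ q⊤) G} zero δ-cong ω-cong
  where
  δ-cong : ∀ {k} {m : Marking k (suc n)} s σ → m ⊨ δ ((A ▷ q⊤) F) s σ → m ⊨ δ ((A ▷ q⊤) G) s σ
  δ-cong zero    σ (c , sat) = c , ⊨ₘ-resp (λ _ → refl) (liftMS-cong F≗G) sat
  δ-cong (suc q) σ h         = h
  ω-cong : ω ((A ▷ q⊤) F) ≗ ω ((A ▷ q⊤) G)
  ω-cong zero    = refl
  ω-cong (suc q) = refl

module Lift {Σ' : Set} {n : ℕ} (A : AAPTA Σ' n) (q⊤ : Fin n) (F : Multiset n) {k : ℕ} where

  A▷F : AAPTA Σ' (suc n)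
  A▷F = (A ▷ q⊤) F

  isSuc : Fin (suc n) → Bool
  isSuc zero    = false
  isSuc (suc _) = true

  -- q_E is sent to the junk value q⊤; it never occurs on a lifted path.
  lower : Fin (suc n) → Fin n
  lower zero    = q⊤
  lower (suc q) = q

  lowerPath : List (Fin k × Fin (suc n)) → List (Fin k × Fin n)
  lowerPath = map (map₂ lower)

  Lifted : List (Fin k × Fin (suc n)) → Set
  Lifted = All (T ∘ isSuc ∘ proj₂)

  lowerPath-∷ʳ : ∀ x a → lowerPath (x ∷ʳ a) ≡ lowerPath x ∷ʳ map₂ lower a
  lowerPath-∷ʳ x a = map-++ (map₂ lower) x (a ∷ [])

  directions-lowerPath : ∀ x → map proj₁ (lowerPath x) ≡ map proj₁ x
  directions-lowerPath []      = refl
  directions-lowerPath (a ∷ x) = cong (proj₁ a ∷_) (directions-lowerPath x)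

  stateOf-lowerPath : ∀ q {x} → Lifted x → stateOf (suc q) x ≡ suc (stateOf q (lowerPath x))
  stateOf-lowerPath q {[]}                []           = refl
  stateOf-lowerPath q {(d , zero)  ∷ x}   (() ∷ _)
  stateOf-lowerPath q {(d , suc r) ∷ x}   (_ ∷ lifted) = stateOf-lowerPath r lifted

  ω-lower : ∀ {s} → T (isSuc s) → ω A (lower s) ≡ ω A▷F s
  ω-lower {suc s} _ = refl

  lift-accepts : ∀ {q} {𝒮 : LTree Σ' k} → Accepts (withInit A q) 𝒮 →
                 Accepts (withInit A▷F (suc q)) 𝒮
  lift-accepts {q} {𝒮} (X , X-acc) = Y , Y-acc
    where
    liftedNode : List (Fin k × Fin (suc n)) → Bool
    liftedNode x = all (isSuc ∘ proj₂) x ∧ node X (lowerPath x)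

    split : ∀ {x} → T (liftedNode x) → Lifted x × T (node X (lowerPath x))
    split {x} h = let l , nd = to T-∧ h in all⁺ _ x l , nd

    lifted-node : ∀ {x} → Lifted x → T (node X (lowerPath x)) → T (liftedNode x)
    lifted-node l nd = from T-∧ (all⁻ _ l , nd)

    closed-lifted : ∀ x a → T (liftedNode (x ∷ʳ a)) → T (liftedNode x)
    closed-lifted x a h =
      let l , nd = split h
      in lifted-node (proj₁ (∷ʳ⁻ l))
           (closed X (lowerPath x) (map₂ lower a) (subst (T ∘ node X) (lowerPath-∷ʳ x a) nd))

    inTree-lifted : ∀ x d s → T (liftedNode (x ∷ʳ (d , s))) → T (mem 𝒮 (map proj₁ x ∷ʳ d))
    inTree-lifted x d s h =
      subst (λ ds → T (mem 𝒮 (ds ∷ʳ d))) (directions-lowerPath x)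
        (inTree X (lowerPath x) d (lower s)
          (subst (T ∘ node X) (lowerPath-∷ʳ x (d , s)) (proj₂ (split h))))

    local-lifted : ∀ x → T (liftedNode x) →
                   childMarking 𝒮 liftedNode x ⊨ δ A▷F (stateOf (suc q) x) (label 𝒮 (map proj₁ x))
    local-lifted x h =
      subst (childMarking 𝒮 liftedNode x ⊨_)
        (cong₂ (δ A▷F) (sym (stateOf-lowerPath q l)) (cong (label 𝒮) (directions-lowerPath x)))
        (⊨-mono {m = liftMarking (childMarking 𝒮 (node X) (lowerPath x))} (dom≡ , ν⊆) _
          (⊨-liftMarking _ _ (local X (lowerPath x) nd)))
      where
      l : Lifted x
      l = proj₁ (split h)
      nd : T (node X (lowerPath x))
      nd = proj₂ (split h)
      dom≡ : ∀ d → mem 𝒮 (map proj₁ (lowerPath x) ∷ʳ d) ≡ mem 𝒮 (map proj₁ x ∷ʳ d)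
      dom≡ d = cong (λ ds → mem 𝒮 (ds ∷ʳ d)) (directions-lowerPath x)
      ν⊆ : ∀ d → T (mem 𝒮 (map proj₁ (lowerPath x) ∷ʳ d)) → ∀ s → T (ν (liftMarking (childMarking 𝒮 (node X) (lowerPath x))) d s) →
           T (liftedNode (x ∷ʳ (d , s)))
      ν⊆ d _ zero    ()
      ν⊆ d _ (suc r) h' =
        lifted-node (∷ʳ⁺ l tt) (subst (T ∘ node X) (sym (lowerPath-∷ʳ x (d , suc r))) h')

    Y : ExecTree (withInit A▷F (suc q)) 𝒮
    Y = record { node = liftedNode ; root = root X ; closed = closed-lifted
               ; inTree = inTree-lifted ; local = local-lifted }

    Y-acc : AcceptingExec Y
    Y-acc β on-Y = ParityAccepting-cong ω≗ (X-acc (map₂ lower ∘ β) on-X)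
      where
      on-X : ∀ i → T (node X (prefix (map₂ lower ∘ β) i))
      on-X i = subst (T ∘ node X) (map-prefix (map₂ lower) β i) (proj₂ (split (on-Y i)))
      ω≗ : ∀ i → ω A (lower (proj₂ (β i))) ≡ ω A▷F (proj₂ (β i))
      ω≗ i = ω-lower (proj₂ (∷ʳ⁻ (proj₁ (split (on-Y (suc i))))))

open Lift using (lift-accepts)

graft-accepts : ∀ {Σ' m k} (B : AAPTA Σ' m) (s : Fin m) (𝒯 : LTree Σ' k) →
                constMarking (λ d → mem 𝒯 (d ∷ [])) s ⊨ δ B (q₀ B) (label 𝒯 []) →
                (∀ d (d∈𝒯 : T (mem 𝒯 (d ∷ []))) → Accepts (withInit B s) (subtree 𝒯 d d∈𝒯)) →
                Accepts B 𝒯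
graft-accepts {m = m} {k = k} B s 𝒯 root-⊨ sub-accepts = Y , Y-acc
  where
  X : ∀ d (d∈𝒯 : T (mem 𝒯 (d ∷ []))) → ExecTree (withInit B s) (subtree 𝒯 d d∈𝒯)
  X d d∈𝒯 = proj₁ (sub-accepts d d∈𝒯)

  graftedNode : List (Fin k × Fin m) → Bool
  graftedNode []             = true
  graftedNode ((d , s') ∷ x) = mem 𝒯 (d ∷ []) ∧ᵈ λ d∈𝒯 → ⌊ s' ≟ s ⌋ ∧ node (X d d∈𝒯) x

  grafted-dir : ∀ {d s' x} → T (graftedNode ((d , s') ∷ x)) → T (mem 𝒯 (d ∷ []))
  grafted-dir = ∧ᵈ-elimˡ

  grafted-elim : ∀ {d s' x} (d∈𝒯 : T (mem 𝒯 (d ∷ []))) → T (graftedNode ((d , s') ∷ x)) →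
                 (s' ≡ s) × T (node (X d d∈𝒯) x)
  grafted-elim d∈𝒯 h = let s'≡s , nd = to T-∧ (∧ᵈ-elimʳ d∈𝒯 h) in toWitness s'≡s , nd

  grafted-intro : ∀ {d x} (d∈𝒯 : T (mem 𝒯 (d ∷ []))) → T (node (X d d∈𝒯) x) →
                  T (graftedNode ((d , s) ∷ x))
  grafted-intro d∈𝒯 nd = ∧ᵈ-intro d∈𝒯 (from T-∧ (fromWitness refl , nd))

  closed-grafted : ∀ x a → T (graftedNode (x ∷ʳ a)) → T (graftedNode x)
  closed-grafted []             a h = tt
  closed-grafted ((d , s') ∷ x) a h with grafted-elim (grafted-dir h) h
  ... | refl , nd = grafted-intro (grafted-dir h) (closed (X d (grafted-dir h)) x a nd)

  inTree-grafted : ∀ x d q → T (graftedNode (x ∷ʳ (d , q))) → T (mem 𝒯 (map proj₁ x ∷ʳ d))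
  inTree-grafted []             d q h = grafted-dir h
  inTree-grafted ((e , s') ∷ x) d q h =
    inTree (X e (grafted-dir h)) x d q (proj₂ (grafted-elim (grafted-dir h) h))

  local-grafted : ∀ x → T (graftedNode x) →
                  childMarking 𝒯 graftedNode x ⊨ δ B (stateOf (q₀ B) x) (label 𝒯 (map proj₁ x))
  local-grafted [] _ = ⊨-mono ((λ _ → refl) , offered) _ root-⊨
    where
    offered : ∀ d (d∈𝒯 : T (mem 𝒯 (d ∷ []))) q → T ⌊ q ≟ s ⌋ → T (graftedNode ((d , q) ∷ []))
    offered d d∈𝒯 q q≟s with toWitness q≟s
    ... | refl = grafted-intro d∈𝒯 (root (X d d∈𝒯))
  local-grafted ((d , s') ∷ x) h with grafted-elim (grafted-dir h) h
  ... | refl , nd =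
    ⊨-mono ((λ _ → refl) , λ _ _ _ → grafted-intro (grafted-dir h)) _
      (local (X d (grafted-dir h)) x nd)

  Y : ExecTree B 𝒯
  Y = record { node = graftedNode ; root = tt ; closed = closed-grafted
             ; inTree = inTree-grafted ; local = local-grafted }

  Y-acc : AcceptingExec Y
  Y-acc β on-Y = ParityAccepting-tail (proj₂ (sub-accepts d d∈𝒯) (β ∘ suc) on-X)
    where
    d : Fin k
    d = proj₁ (β 0)
    d∈𝒯 : T (mem 𝒯 (d ∷ []))
    d∈𝒯 = grafted-dir (on-Y 1)
    on-X : ∀ i → T (node (X d d∈𝒯) (prefix (β ∘ suc) i))
    on-X i = proj₂ (grafted-elim d∈𝒯 (subst (T ∘ graftedNode) (prefix-tail β i) (on-Y (suc i))))

▷-empty-accepts : ∀ {Σ' n} (A : AAPTA Σ' n) (q⊤ : Fin n) →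
                  (∀ {k} (𝒮 : LTree Σ' k) → Accepts (withInit A q⊤) 𝒮) →
                  ∀ {k} (𝒯 : LTree Σ' k) → Accepts ((A ▷ q⊤) (λ _ → 0)) 𝒯
▷-empty-accepts A q⊤ q⊤-accepts 𝒯 =
  graft-accepts ((A ▷ q⊤) (λ _ → 0)) (suc q⊤) 𝒯
    (constMarking-⊨ _ (suc q⊤) λ { zero → refl ; (suc _) → refl })
    (λ d d∈𝒯 → lift-accepts A q⊤ (λ _ → 0) (q⊤-accepts (subtree 𝒯 d d∈𝒯)))

proposition5 : ExcludedMiddle 0ℓ →
    {Σ' : Set} {n : ℕ} (A : AAPTA Σ' n) (q⊤ : Fin n) →
    (∀ {k} (𝒮 : LTree Σ' k) → Accepts (withInit A q⊤) 𝒮) →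
    (E : Multiset n) {k : ℕ} (𝒯 : LTree Σ' k) →
    Rejects ((A ▷ q⊤) E) 𝒯 →
    ∃₂ λ (F : Multiset n) (g : Fin n) →
      (F ⊑ E) × (g ∈supp (E ⊖ F)) ×
      Accepts ((A ▷ q⊤) F) 𝒯 × Rejects ((A ▷ q⊤) (F ⊎ₘ ｛ g ｝ₘ)) 𝒯
proposition5 lem A q⊤ q⊤-accepts E 𝒯 E-rejects =
  boundary-increment lem (λ F → Accepts ((A ▷ q⊤) F) 𝒯) (▷-accepts-cong A q⊤)
    E (λ _ → 0) (λ _ → z≤n) (▷-empty-accepts A q⊤ q⊤-accepts 𝒯) E-rejects
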